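{- Let $F$ be a finite forest with no cherry, no isolated vertex and no connected component consisting of a single edge. If $S_F=\emptyset$, then $o(F)=\mathcal{A}$.
   Context: Maker-Maker domination game on a finite simple graph $G$: Alice and Bob alternately claim previously unclaimed vertices, Alice first; the first player whose claimed vertices form a dominating set of $G$ wins; if all vertices are claimed and nobody dominates, it is a draw. $o(G)=\mathcal{A}$ if Alice has a winning strategy and $o(G)=\mathcal{D}$ otherwise. A leaf is a vertex of degree 1; a cherry is a vertex adjacent to two distinct leaves. $L_F$ is the set of leaves of $F$, $M_F$ the set of vertices adjacent to a leaf, and $S_F=V(F)\setminus(L_F\cup M_F)$ (the skeleton of $F$). -}

module Defs where

open import Data.Nat using (ℕ; zero; suc; _+_)
open import Data.Bool using (Bool; true; false; T; if_then_else_)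
open import Data.Fin using (Fin; zero; suc; inject₁; fromℕ)
open import Data.Fin.Subset using (Subset; _∈_; _∉_; _∪_; ⁅_⁆; ⊥)
open import Data.List using (List; map; allFin)
open import Data.Nat.ListAction using (sum)
open import Data.Product using (Σ; ∃; _×_; _,_)
open import Data.Sum using (_⊎_)
open import Relation.Binary.PropositionalEquality using (_≡_; _≢_)
open import Relation.Nullary using (¬_)

record Graph (n : ℕ) : Set where
  field
    adj   : Fin n → Fin n → Bool
    sym   : ∀ u v → adj u v ≡ adj v u
    irref : ∀ v → adj v v ≡ false

module _ {n : ℕ} (G : Graph n) where
  open Graph G

  Adj : Fin n → Fin n → Set
  Adj u v = T (adj u v)

  degree : Fin n → ℕ
  degree v = sum (map (λ u → if adj v u then 1 else 0) (allFin n))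

  IsLeaf : Fin n → Set
  IsLeaf v = degree v ≡ 1

  IsIsolated : Fin n → Set
  IsIsolated v = degree v ≡ 0

  InM : Fin n → Set
  InM v = ∃ λ u → Adj v u × IsLeaf u

  InSkeleton : Fin n → Set
  InSkeleton v = ¬ IsLeaf v × ¬ InM v

  IsCherry : Fin n → Set
  IsCherry v = Σ (Fin n) λ u → Σ (Fin n) λ w →
    u ≢ w × Adj v u × Adj v w × IsLeaf u × IsLeaf w

  Cycle : Set
  Cycle = Σ ℕ λ k → Σ (Fin (suc (suc (suc k))) → Fin n) λ c →
    (∀ i j → c i ≡ c j → i ≡ j) ×
    (∀ (i : Fin (suc (suc k))) → Adj (c (inject₁ i)) (c (suc i))) ×
    Adj (c (fromℕ (suc (suc k)))) (c zero)

  IsForest : Set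
  IsForest = ¬ Cycle

  SingleEdgeComponent : Set
  SingleEdgeComponent = Σ (Fin n) λ u → Σ (Fin n) λ v →
    Adj u v × IsLeaf u × IsLeaf v

  Dominates : Subset n → Set
  Dominates D = ∀ v → v ∈ D ⊎ (∃ λ u → u ∈ D × Adj u v)

  -- Maker-Maker domination game.  Position: (A , B) = vertices claimed by
  -- Alice and Bob, with Alice to move and nobody dominating yet.
  data AliceWins (A B : Subset n) : Set where
    move : (v : Fin n) → v ∉ A → v ∉ B →
           Dominates (A ∪ ⁅ v ⁆) ⊎
             ((∃ λ w → w ∉ (A ∪ ⁅ v ⁆) × w ∉ B) ×
              (∀ w → w ∉ (A ∪ ⁅ v ⁆) → w ∉ B →
                 ¬ Dominates (B ∪ ⁅ w ⁆) × AliceWins (A ∪ ⁅ v ⁆) (B ∪ ⁅ w ⁆))) →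
           AliceWins A B

  OutcomeA : Set
  OutcomeA = AliceWins ⊥ ⊥

{-# OPTIONS --safe #-}
module Submission where

open import Defs
open import Data.Nat using (ℕ; _≤_; _≟_; z≤n; s≤s)
open import Data.Nat.Properties using (≤-trans; m≤n+m; 1+n≰n)
open import Data.Nat.ListAction using (sum)
open import Data.Bool using (Bool; true; false; T; if_then_else_)
open import Data.Fin using (Fin; fromℕ<)
open import Data.Fin.Properties using (all?; any?; ¬∀⟶∃¬)
  renaming (_≟_ to _≟ᶠ_)
open import Data.Fin.Subset using (Subset; _∈_; _∉_; _∪_; ⁅_⁆; ⊥; _⊂_; _⊃_)
open import Data.Fin.Subset.Properties
  using (_∈?_; ∉⊥; x∈⁅x⁆; x∈⁅y⁆⇒x≡y; x∈p∪q⁻; x∈p∪q⁺; p⊆p∪q)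
open import Data.Fin.Subset.Induction using (⊃-wellFounded)
open import Data.List using (List; _∷_; map; allFin)
open import Data.List.Relation.Unary.Any using (here; there)
import Data.List.Membership.Propositional as List
open import Data.List.Membership.Propositional.Properties using (∈-allFin)
open import Data.Product using (∃; _×_; _,_; proj₁; proj₂)
open import Data.Sum using (_⊎_; inj₁; inj₂; [_,_]′; swap; map₂)
open import Data.Empty using (⊥-elim)
open import Function using (_∘_)
open import Induction.WellFounded using (Acc; acc)
open import Relation.Binary.PropositionalEquality
  using (_≡_; _≢_; refl; sym; trans; cong; subst)
open import Relation.Nullary using (¬_; Dec; yes; no)
open import Relation.Nullary.Decidable using (T?; _×-dec_; _⊎-dec_)

-- Since every vertex is a leaf or a support vertex, and no support vertex
-- has two leaves and no two leaves are adjacent, the leaves together with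
-- their supports form a perfect matching, and a set dominates exactly when
-- it meets every edge of this matching.  Alice then plays a pairing
-- strategy: whenever Bob takes a vertex whose partner is free she takes the
-- partner, and otherwise she starts a fresh pair.  She always holds one
-- pair half-claimed with its other vertex free, which Bob can only take at
-- a moment when Alice already meets every pair Bob meets; so Bob never
-- dominates first, while Alice keeps claiming until she dominates.

-- `degree G v` is definitionally `countTrue (adj v) (allFin n)`.
countTrue : {A : Set} → (A → Bool) → List A → ℕ
countTrue f xs = sum (map (λ x → if f x then 1 else 0) xs)

module _ {A : Set} {f : A → Bool} where

  countTrue-∈ : ∀ {x xs} → x List.∈ xs → T (f x) → 1 ≤ countTrue f xs
  countTrue-∈ {x} (here refl) t with f x
  ... | true = s≤s z≤n
  countTrue-∈ (there x∈xs) t = ≤-trans (countTrue-∈ x∈xs t) (m≤n+m _ _)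

  countTrue-∈₂ : ∀ {a b xs} → a List.∈ xs → b List.∈ xs → a ≢ b →
                 T (f a) → T (f b) → 2 ≤ countTrue f xs
  countTrue-∈₂ (here refl) (here refl) a≢b _ _ = ⊥-elim (a≢b refl)
  countTrue-∈₂ {a} (here refl) (there b∈xs) _ ta tb with f a
  ... | true = s≤s (countTrue-∈ b∈xs tb)
  countTrue-∈₂ {b = b} (there a∈xs) (here refl) _ ta tb with f b
  ... | true = s≤s (countTrue-∈ a∈xs ta)
  countTrue-∈₂ (there a∈xs) (there b∈xs) a≢b ta tb =
    ≤-trans (countTrue-∈₂ a∈xs b∈xs a≢b ta tb) (m≤n+m _ _)

  countTrue-witness : ∀ xs → 1 ≤ countTrue f xs → ∃ λ x → T (f x)
  countTrue-witness (x ∷ xs) pos with f x in fx≡true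
  ... | true  = x , subst T (sym fx≡true) _
  ... | false = countTrue-witness xs pos

module _ {n : ℕ} (G : Graph n) where
  open Graph G using (adj)

  Adj-sym : ∀ {u v} → Adj G u v → Adj G v u
  Adj-sym {u} {v} = subst T (Graph.sym G u v)

  leaf? : ∀ v → Dec (IsLeaf G v)
  leaf? v = degree G v ≟ 1

  leaf-neighbour : ∀ {v} → IsLeaf G v → ∃ (Adj G v)
  leaf-neighbour leaf =
    countTrue-witness (allFin n) (subst (1 ≤_) (sym leaf) (s≤s z≤n))

  leaf-neighbour-unique : ∀ {v a b} → IsLeaf G v → Adj G v a → Adj G v b → a ≡ b
  leaf-neighbour-unique {v} {a} {b} leaf va vb with a ≟ᶠ b
  ... | yes a≡b = a≡b
  ... | no a≢b  = ⊥-elim (1+n≰n (subst (2 ≤_) leaf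
                    (countTrue-∈₂ (∈-allFin a) (∈-allFin b) a≢b va vb)))

  dominates? : ∀ D → Dec (Dominates G D)
  dominates? D = all? λ v → (v ∈? D) ⊎-dec any? λ u → (u ∈? D) ×-dec T? (adj u v)

  Dominates-leaf : ∀ {D v w} → Dominates G D → IsLeaf G v → Adj G v w → v ∈ D ⊎ w ∈ D
  Dominates-leaf {D} {v} dom leaf vw with dom v
  ... | inj₁ v∈D             = inj₁ v∈D
  ... | inj₂ (u , u∈D , uv) =
    inj₂ (subst (_∈ D) (leaf-neighbour-unique leaf (Adj-sym uv) vw) u∈D)

  ¬Dominates-⊥ : Fin n → ¬ Dominates G ⊥
  ¬Dominates-⊥ v dom = [ ∉⊥ , ∉⊥ ∘ proj₁ ∘ proj₂ ]′ (dom v)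

module _ {n : ℕ} {A : Subset n} where

  x∈p∪⁅x⁆ : ∀ x → x ∈ A ∪ ⁅ x ⁆
  x∈p∪⁅x⁆ x = x∈p∪q⁺ (inj₂ (x∈⁅x⁆ x))

  x∈p∪⁅y⁆⁻ : ∀ {x} y → x ∈ A ∪ ⁅ y ⁆ → x ∈ A ⊎ x ≡ y
  x∈p∪⁅y⁆⁻ y = map₂ (x∈⁅y⁆⇒x≡y y) ∘ x∈p∪q⁻ A ⁅ y ⁆

  x∉p∪⁅y⁆ : ∀ {x y} → x ∉ A → x ≢ y → x ∉ A ∪ ⁅ y ⁆
  x∉p∪⁅y⁆ {y = y} x∉A x≢y = [ x∉A , x≢y ]′ ∘ x∈p∪⁅y⁆⁻ y

  x∉p⇒p⊂p∪⁅x⁆ : ∀ {x} → x ∉ A → A ⊂ A ∪ ⁅ x ⁆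
  x∉p⇒p⊂p∪⁅x⁆ {x} x∉A = p⊆p∪q ⁅ x ⁆ , x , x∈p∪⁅x⁆ x , x∉A

record PendantMatching {n : ℕ} (G : Graph n) : Set where
  field
    partner            : Fin n → Fin n
    partner-involutive : ∀ v → partner (partner v) ≡ v
    partner-adjacent   : ∀ v → Adj G v (partner v)
    pair-has-leaf      : ∀ v → IsLeaf G v ⊎ IsLeaf G (partner v)

module PairingStrategy {n : ℕ} {G : Graph n} (M : PendantMatching G) where
  open PendantMatching M

  partner-≢ : ∀ v → partner v ≢ v
  partner-≢ v pv≡v = subst T (Graph.irref G v) (subst (Adj G v) pv≡v (partner-adjacent v))

  partner-injective : ∀ {a b} → partner a ≡ partner b → a ≡ b
  partner-injective {a} {b} e =
    trans (sym (partner-involutive a)) (trans (cong partner e) (partner-involutive b))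

  HitsPairs : Subset n → Set
  HitsPairs D = ∀ u → u ∈ D ⊎ partner u ∈ D

  hitsPairs? : ∀ D u → Dec (u ∈ D ⊎ partner u ∈ D)
  hitsPairs? D u = (u ∈? D) ⊎-dec (partner u ∈? D)

  Dominates⇒HitsPairs : ∀ {D} → Dominates G D → HitsPairs D
  Dominates⇒HitsPairs dom u with pair-has-leaf u
  ... | inj₁ u-leaf  = Dominates-leaf G dom u-leaf (partner-adjacent u)
  ... | inj₂ pu-leaf = swap (Dominates-leaf G dom pu-leaf (Adj-sym G (partner-adjacent u)))

  HitsPairs⇒Dominates : ∀ {D} → HitsPairs D → Dominates G D
  HitsPairs⇒Dominates hits u with hits u
  ... | inj₁ u∈D  = inj₁ u∈D
  ... | inj₂ pu∈D = inj₂ (partner u , pu∈D , Adj-sym G (partner-adjacent u))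

  Covers : Subset n → Subset n → Set
  Covers A B = ∀ {x} → x ∈ B → partner x ∈ A

  Reserve : Subset n → Subset n → Set
  Reserve A B = ∃ λ a → a ∈ A × partner a ∉ A × partner a ∉ B

  -- The invariant Alice maintains after each of her moves.
  Ahead : Subset n → Subset n → Set
  Ahead A B = ¬ Dominates G A × Covers A B × Reserve A B

  GoodMove : Subset n → Subset n → Set
  GoodMove A B = ∃ λ v → v ∉ A × v ∉ B ×
                 (Dominates G (A ∪ ⁅ v ⁆) ⊎ Ahead (A ∪ ⁅ v ⁆) B)

  Covers-HitsPairs : ∀ {A B} → Covers A B → HitsPairs B → HitsPairs A
  Covers-HitsPairs {A} cover hitsB u with hitsB u
  ... | inj₁ u∈B  = inj₂ (cover u∈B)
  ... | inj₂ pu∈B = inj₁ (subst (_∈ A) (partner-involutive u) (cover pu∈B))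

  Covers-∪ʳ : ∀ {A B w} → Covers A B → partner w ∈ A → Covers A (B ∪ ⁅ w ⁆)
  Covers-∪ʳ {w = w} cover pw∈A x∈B∪w with x∈p∪⁅y⁆⁻ w x∈B∪w
  ... | inj₁ x∈B = cover x∈B
  ... | inj₂ refl = pw∈A

  Covers-∪ˡ : ∀ {A B v} → Covers A B → Covers (A ∪ ⁅ v ⁆) B
  Covers-∪ˡ {v = v} cover = p⊆p∪q ⁅ v ⁆ ∘ cover

  settle : ∀ {A B} → Covers A B → Reserve A B → Dominates G A ⊎ Ahead A B
  settle {A} cover reserve with dominates? G A
  ... | yes dom  = inj₁ dom
  ... | no ¬dom = inj₂ (¬dom , cover , reserve)

  bob-cannot-win : ∀ {A B w} → Ahead A B → w ∉ A → ¬ Dominates G (B ∪ ⁅ w ⁆)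
  bob-cannot-win {A} {B} {w} (¬domA , cover , a , a∈A , pa∉A , pa∉B) w∉A domB =
    ¬domA (HitsPairs⇒Dominates (Covers-HitsPairs (Covers-∪ʳ cover pw∈A) hitsB))
    where
    hitsB : HitsPairs (B ∪ ⁅ w ⁆)
    hitsB = Dominates⇒HitsPairs domB

    -- Bob meets the reserve pair only through its free vertex.
    pw∈A : partner w ∈ A
    pw∈A with hitsB a
    ... | inj₁ a∈B∪w with x∈p∪⁅y⁆⁻ w a∈B∪w
    ...   | inj₁ a∈B  = ⊥-elim (pa∉A (cover a∈B))
    ...   | inj₂ refl = ⊥-elim (w∉A a∈A)
    pw∈A | inj₂ pa∈B∪w with x∈p∪⁅y⁆⁻ w pa∈B∪w
    ...   | inj₁ pa∈B = ⊥-elim (pa∉B pa∈B)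
    ...   | inj₂ refl = subst (_∈ A) (sym (partner-involutive a)) a∈A

  open-pair : ∀ {A B} → ¬ Dominates G A → Covers A B → GoodMove A B
  open-pair {A} {B} ¬domA cover =
    v , v∉A , v∉B , settle (Covers-∪ˡ cover) (v , x∈p∪⁅x⁆ v , x∉p∪⁅y⁆ pv∉A (partner-≢ v) , pv∉B)
    where
    untouched : ∃ λ v → ¬ (v ∈ A ⊎ partner v ∈ A)
    untouched = ¬∀⟶∃¬ n _ (hitsPairs? A) (¬domA ∘ HitsPairs⇒Dominates)

    v = proj₁ untouched

    v∉A : v ∉ A
    v∉A = proj₂ untouched ∘ inj₁

    pv∉A : partner v ∉ A
    pv∉A = proj₂ untouched ∘ inj₂

    v∉B : v ∉ B
    v∉B = pv∉A ∘ cover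

    pv∉B : partner v ∉ B
    pv∉B = v∉A ∘ subst (_∈ A) (partner-involutive v) ∘ cover

  reply : ∀ {A B w} → Ahead A B → w ∉ A → w ∉ B → GoodMove A (B ∪ ⁅ w ⁆)
  reply {A} {B} {w} (¬domA , cover , _) _ _ with partner w ∈? A
  ... | yes pw∈A = open-pair ¬domA (Covers-∪ʳ cover pw∈A)
  reply {A} {B} {w} (¬domA , cover , a , a∈A , pa∉A , pa∉B) w∉A w∉B | no pw∉A =
    partner w , pw∉A , x∉p∪⁅y⁆ pw∉B (partner-≢ w) ,
    settle (Covers-∪ʳ (Covers-∪ˡ cover) (x∈p∪⁅x⁆ (partner w)))
           (a , p⊆p∪q _ a∈A , x∉p∪⁅y⁆ pa∉A pa≢pw , x∉p∪⁅y⁆ pa∉B pa≢w)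
    where
    pw∉B : partner w ∉ B
    pw∉B = w∉A ∘ subst (_∈ A) (partner-involutive w) ∘ cover

    pa≢pw : partner a ≢ partner w
    pa≢pw pa≡pw = w∉A (subst (_∈ A) (partner-injective pa≡pw) a∈A)

    pa≢w : partner a ≢ w
    pa≢w refl = pw∉A (subst (_∈ A) (sym (partner-involutive a)) a∈A)

  play : ∀ {A B} → Acc _⊃_ A → GoodMove A B → AliceWins G A B
  play (acc _) (v , v∉A , v∉B , inj₁ dom) = move v v∉A v∉B (inj₁ dom)
  play (acc smaller) (v , v∉A , v∉B , inj₂ ahead@(_ , _ , a , _ , pa∉A , pa∉B)) =
    move v v∉A v∉B (inj₂ ((partner a , pa∉A , pa∉B) , λ w w∉A w∉B →
      bob-cannot-win ahead w∉A ,
      play (smaller (x∉p⇒p⊂p∪⁅x⁆ v∉A)) (reply ahead w∉A w∉B)))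

  alice-wins : 1 ≤ n → OutcomeA G
  alice-wins 1≤n =
    play (⊃-wellFounded ⊥) (open-pair (¬Dominates-⊥ G (fromℕ< 1≤n)) (⊥-elim ∘ ∉⊥))

module _ {n : ℕ} (F : Graph n)
  (no-cherry : ∀ v → ¬ IsCherry F v)
  (no-K₂ : ¬ SingleEdgeComponent F)
  (no-skeleton : ∀ v → ¬ InSkeleton F v) where

  leaf-or-support : ∀ v → IsLeaf F v ⊎ InM F v
  leaf-or-support v with leaf? F v
  ... | yes leaf = inj₁ leaf
  ... | no ¬leaf with any? (λ u → T? (Graph.adj F v u) ×-dec leaf? F u)
  ...   | yes support = inj₂ support
  ...   | no ¬support = ⊥-elim (no-skeleton v (¬leaf , ¬support))

  support-leaf-unique : ∀ {v a b} → Adj F v a → Adj F v b →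
                        IsLeaf F a → IsLeaf F b → a ≡ b
  support-leaf-unique {v} {a} {b} va vb a-leaf b-leaf with a ≟ᶠ b
  ... | yes a≡b = a≡b
  ... | no a≢b  = ⊥-elim (no-cherry v (a , b , a≢b , va , vb , a-leaf , b-leaf))

  matched-neighbour : ∀ v → ∃ λ u → Adj F v u × (IsLeaf F v ⊎ IsLeaf F u)
  matched-neighbour v with leaf-or-support v
  ... | inj₁ leaf = let (u , vu) = leaf-neighbour F leaf in u , vu , inj₁ leaf
  ... | inj₂ (u , vu , u-leaf) = u , vu , inj₂ u-leaf

  pendantMatching : PendantMatching F
  pendantMatching = record
    { partner            = partner
    ; partner-involutive = involutive
    ; partner-adjacent   = adjacent
    ; pair-has-leaf      = has-leaf
    }
    where
    partner : Fin n → Fin n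
    partner = proj₁ ∘ matched-neighbour

    adjacent : ∀ v → Adj F v (partner v)
    adjacent = proj₁ ∘ proj₂ ∘ matched-neighbour

    has-leaf : ∀ v → IsLeaf F v ⊎ IsLeaf F (partner v)
    has-leaf = proj₂ ∘ proj₂ ∘ matched-neighbour

    involutive : ∀ v → partner (partner v) ≡ v
    involutive v with has-leaf v | has-leaf (partner v)
    ... | inj₂ pv-leaf | _ =
      leaf-neighbour-unique F pv-leaf (adjacent (partner v)) (Adj-sym F (adjacent v))
    ... | inj₁ v-leaf | inj₁ pv-leaf = ⊥-elim (no-K₂ (v , partner v , adjacent v , v-leaf , pv-leaf))
    ... | inj₁ v-leaf | inj₂ ppv-leaf =
      support-leaf-unique (adjacent (partner v)) (Adj-sym F (adjacent v)) ppv-leaf v-leaf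

lemma21 : ∀ {n} → 1 ≤ n → (F : Graph n) → IsForest F →
          (∀ v → ¬ IsCherry F v) →
          (∀ v → ¬ IsIsolated F v) →
          ¬ SingleEdgeComponent F →
          (∀ v → ¬ InSkeleton F v) →
          OutcomeA F
lemma21 1≤n F _ no-cherry _ no-K₂ no-skeleton =
  PairingStrategy.alice-wins (pendantMatching F no-cherry no-K₂ no-skeleton) 1≤n
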